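{- If $r\geq 3$ and $n\geq r+1$ are integers, then $\sigma(K_{r+1}-P_2,n)\geq (r-1)(2n-r)-2(n-r)+2$.
   Context: A sequence $\pi=(d_1,\dots,d_n)$ of non-increasing nonnegative integers is graphic if it is the degree sequence of a simple graph on $n$ vertices (a realization of $\pi$); $\sigma(\pi)=d_1+\cdots+d_n$. For a graph $F$, a graphic sequence is potentially $F$-graphical if some realization contains $F$ as a subgraph. $\sigma(F,n)$ denotes the minimum even integer $l$ such that every $n$-term graphic sequence $\pi$ with $\sigma(\pi)\geq l$ is potentially $F$-graphical. $P_2$ is the path on $3$ vertices, and $K_{r+1}-P_2$ is the complete graph $K_{r+1}$ with the two edges of a path on $3$ of its vertices removed. -}

module Defs where

open import Data.Nat using (ℕ; zero; suc; _+_; _*_; _∸_; _≤_)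
open import Data.Nat.Divisibility using (_∣_)
open import Data.Fin using (Fin; toℕ) renaming (_≤_ to _≤ᶠ_)
open import Data.Bool using (Bool; true; false; if_then_else_)
open import Data.List using (map; allFin)
open import Data.Nat.ListAction using (sum)
open import Data.Product using (Σ; _×_; ∃)
open import Data.Sum using (_⊎_)
open import Relation.Binary.PropositionalEquality using (_≡_; _≢_)
open import Relation.Nullary using (¬_)
open import Function.Definitions using (Injective)

record Graph (n : ℕ) : Set where
  field
    adj    : Fin n → Fin n → Bool
    sym    : ∀ i j → adj i j ≡ adj j i
    irrefl : ∀ i → adj i i ≡ false
open Graph public

degree : ∀ {n} → Graph n → Fin n → ℕ
degree {n} G i = sum (map (λ j → if adj G i j then 1 else 0) (allFin n))

Seq : ℕ → Set
Seq n = Fin n → ℕ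

NonIncreasing : ∀ {n} → Seq n → Set
NonIncreasing {n} d = ∀ (i j : Fin n) → i ≤ᶠ j → d j ≤ d i

σ : ∀ {n} → Seq n → ℕ
σ {n} d = sum (map d (allFin n))

Realizes : ∀ {n} → Graph n → Seq n → Set
Realizes G d = ∀ i → degree G i ≡ d i

Graphic : ∀ {n} → Seq n → Set
Graphic {n} d = NonIncreasing d × Σ (Graph n) (λ G → Realizes G d)

-- Edges of K_{r+1} - P_2 on vertex set Fin (r+1):
-- all pairs of distinct vertices except {0,1} and {0,2}
-- (the removed P_2 is the path 1 - 0 - 2).
P2Edge : ∀ {m} → Fin m → Fin m → Set
P2Edge i j = (toℕ i ≡ 0 × (toℕ j ≡ 1 ⊎ toℕ j ≡ 2))
           ⊎ (toℕ j ≡ 0 × (toℕ i ≡ 1 ⊎ toℕ i ≡ 2))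

KMinusP2Edge : (r : ℕ) → Fin (suc r) → Fin (suc r) → Set
KMinusP2Edge r i j = i ≢ j × ¬ P2Edge i j

ContainsKMinusP2 : ∀ {n} → (r : ℕ) → Graph n → Set
ContainsKMinusP2 {n} r G =
  Σ (Fin (suc r) → Fin n) (λ f →
    Injective _≡_ _≡_ f ×
    (∀ i j → KMinusP2Edge r i j → adj G (f i) (f j) ≡ true))

PotentiallyKMinusP2 : ∀ {n} → (r : ℕ) → Seq n → Set
PotentiallyKMinusP2 {n} r d =
  Σ (Graph n) (λ G → Realizes G d × ContainsKMinusP2 r G)

SigmaBound : (r n l : ℕ) → Set
SigmaBound r n l = ∀ (d : Seq n) → Graphic d → l ≤ σ d → PotentiallyKMinusP2 r d

-- σ(K_{r+1}-P_2, n) ≥ b : every even l with the defining property is ≥ b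
SigmaKMinusP2AtLeast : (r n b : ℕ) → Set
SigmaKMinusP2AtLeast r n b = ∀ l → 2 ∣ l → SigmaBound r n l → b ≤ l

-- Put k = r − 3 and π = ((n−1)^k, (r−1)^(n−k)). It is graphic, realized by the join of the
-- complete graph K_k with the cycle C_(n−k), and σ(π) = (r−1)(2n−r) − 2(n−r) is even. It is not
-- potentially (K_(r+1) − P_2)-graphical: the r − 2 vertices of K_(r+1) − P_2 off the removed path
-- have degree r in any host graph, whereas a realization of π has only k = r − 3 vertices of
-- degree ≥ r. So no even l ≤ σ(π) has the defining property of σ(K_(r+1) − P_2, n).

module Submission where

open import Data.Bool using (Bool; true; false; not; _∨_; if_then_else_)
open import Data.Bool.Properties using (∨-comm)
open import Data.Fin using (Fin; toℕ; fromℕ<; punchIn; punchOut; _↑ˡ_; _↑ʳ_; splitAt)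
open import Data.Fin.Properties as Fin using (_≟_; punchInᵢ≢i)
open import Data.List using ([]; _∷_; map; allFin; tabulate)
open import Data.List.Properties using (map-tabulate)
open import Data.Nat using (ℕ; zero; suc; _+_; _*_; _∸_; _≤_; _<_; z≤n; s≤s; s≤s⁻¹; z<s; s<s)
open import Data.Nat using (NonZero; >-nonZero; >-nonZero⁻¹)
open import Data.Nat.Divisibility using (_∣_; divides; ∣⇒≤; ∣m∣n⇒∣m+n; m∣m*n)
open import Data.Nat.DivMod
  using (_%_; _/_; _mod_; %-distribˡ-+; m%n%n≡m%n; [m+n]%n≡m%n; m<n⇒m%n≡m; m≡m%n+[m/n]*n)
import Data.Nat.ListAction as List
open import Data.Nat.Properties hiding (_≟_)
open import Data.Nat.Tactic.RingSolver using (solve)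
open import Data.Product using (Σ; _×_; _,_)
open import Data.Sum using (_⊎_; inj₁; inj₂; [_,_]′)
open import Defs hiding (sym)
open import Function using (_∘_; id; const)
open import Function.Bundles using (mk⇔)
open import Function.Definitions using (Injective)
open import Relation.Binary.PropositionalEquality
open import Relation.Nullary using (¬_)
open import Relation.Nullary.Decidable using (does; yes; no; dec-true; dec-false; does-⇔)
open import Algebra.Properties.CommutativeMonoid.Sum +-0-commutativeMonoid
  using (sum-remove; sum-cong-≗; ∑-distrib-+) renaming (sum to ∑)

χ : Bool → ℕ
χ b = if b then 1 else 0

∑-tabulate : ∀ n (f : Fin n → ℕ) → List.sum (tabulate f) ≡ ∑ f
∑-tabulate zero    f = refl
∑-tabulate (suc n) f = cong (f Fin.zero +_) (∑-tabulate n (f ∘ Fin.suc))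

∑-allFin : ∀ {n} (f : Fin n → ℕ) → List.sum (map f (allFin n)) ≡ ∑ f
∑-allFin {n} f = trans (cong List.sum (map-tabulate id f)) (∑-tabulate n f)

degree≡∑ : ∀ {n} (G : Graph n) v → degree G v ≡ ∑ (χ ∘ adj G v)
degree≡∑ G v = ∑-allFin (χ ∘ adj G v)

∑-cong : ∀ {n} {f g : Fin n → ℕ} → (∀ i → f i ≡ g i) → ∑ f ≡ ∑ g
∑-cong = sum-cong-≗

∑-const : ∀ n c → ∑ {n} (const c) ≡ n * c
∑-const zero    c = refl
∑-const (suc n) c = cong (c +_) (∑-const n c)

∑-↑ : ∀ k {m} (f : Fin (k + m) → ℕ) → ∑ f ≡ ∑ (f ∘ (_↑ˡ m)) + ∑ (f ∘ (k ↑ʳ_))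
∑-↑ zero    f = refl
∑-↑ (suc k) f =
  trans (cong (f Fin.zero +_) (∑-↑ k (f ∘ Fin.suc))) (sym (+-assoc (f Fin.zero) _ _))

∑-punchIn : ∀ {n c} (f : Fin (suc n) → ℕ) i → (∀ j → f (punchIn i j) ≡ c) → ∑ f ≡ f i + n * c
∑-punchIn {n} {c} f i f≡c =
  trans (sum-remove f) (cong (f i +_) (trans (∑-cong f≡c) (∑-const n c)))

∑-χ-≟ : ∀ {n} (i : Fin n) → ∑ (λ j → χ (does (j ≟ i))) ≡ 1
∑-χ-≟ {suc n} i = begin
  ∑ (λ j → χ (does (j ≟ i)))  ≡⟨ ∑-punchIn (λ j → χ (does (j ≟ i))) i others ⟩
  χ (does (i ≟ i)) + n * 0    ≡⟨ cong₂ _+_ (cong χ (dec-true (i ≟ i) refl)) (*-zeroʳ n) ⟩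
  1                           ∎
  where
  open ≡-Reasoning
  others : ∀ j → χ (does (punchIn i j ≟ i)) ≡ 0
  others j = cong χ (dec-false (punchIn i j ≟ i) (punchInᵢ≢i i j))

∑-χ-≢ : ∀ {n} (i : Fin n) → ∑ (λ j → χ (not (does (i ≟ j)))) ≡ n ∸ 1
∑-χ-≢ {suc n} i = begin
  ∑ (λ j → χ (not (does (i ≟ j))))  ≡⟨ ∑-punchIn (λ j → χ (not (does (i ≟ j)))) i others ⟩
  χ (not (does (i ≟ i))) + n * 1    ≡⟨ cong₂ _+_ (cong (χ ∘ not) (dec-true (i ≟ i) refl)) (*-identityʳ n) ⟩
  n                                 ∎
  where
  open ≡-Reasoning
  others : ∀ j → χ (not (does (i ≟ punchIn i j))) ≡ 1
  others j = cong (χ ∘ not) (dec-false (i ≟ punchIn i j) (punchInᵢ≢i i j ∘ sym))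

χ-∨-≟ : ∀ {n} {a b : Fin n} → a ≢ b → ∀ y →
        χ (does (y ≟ a) ∨ does (y ≟ b)) ≡ χ (does (y ≟ a)) + χ (does (y ≟ b))
χ-∨-≟ {a = a} a≢b y with y ≟ a
... | yes refl = cong (λ c → 1 + χ c) (sym (dec-false (y ≟ _) a≢b))
... | no  _    = refl

injective⇒≤∑χ : ∀ {s n} (p : Fin n → Bool) (g : Fin s → Fin n) → Injective _≡_ _≡_ g →
                (∀ t → p (g t) ≡ true) → s ≤ ∑ (χ ∘ p)
injective⇒≤∑χ {zero}          p g g-inj p∘g = z≤n
injective⇒≤∑χ {suc s} {zero}  p g g-inj p∘g with g Fin.zero
... | ()
injective⇒≤∑χ {suc s} {suc n} p g g-inj p∘g = begin
  suc s                            ≤⟨ s≤s (injective⇒≤∑χ (p ∘ punchIn v) g′ g′-inj p∘g′) ⟩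
  χ true + ∑ (χ ∘ p ∘ punchIn v)   ≡⟨ cong (λ b → χ b + ∑ (χ ∘ p ∘ punchIn v)) (p∘g Fin.zero) ⟨
  χ (p v) + ∑ (χ ∘ p ∘ punchIn v)  ≡⟨ sum-remove (χ ∘ p) ⟨
  ∑ (χ ∘ p)                        ∎
  where
  open ≤-Reasoning
  v : Fin (suc n)
  v = g Fin.zero
  v≢g : ∀ t → v ≢ g (Fin.suc t)
  v≢g t = Fin.0≢1+n ∘ g-inj
  g′ : Fin s → Fin n
  g′ t = punchOut (v≢g t)
  g′-inj : Injective _≡_ _≡_ g′
  g′-inj e = Fin.suc-injective (g-inj (Fin.punchOut-injective (v≢g _) (v≢g _) e))
  p∘g′ : ∀ t → p (punchIn v (g′ t)) ≡ true
  p∘g′ t = trans (cong p (Fin.punchIn-punchOut (v≢g t))) (p∘g (Fin.suc t))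

injective⇒≤degree : ∀ {s n} (G : Graph n) v (g : Fin s → Fin n) → Injective _≡_ _≡_ g →
                    (∀ t → adj G v (g t) ≡ true) → s ≤ degree G v
injective⇒≤degree G v g g-inj adj-g =
  subst (_ ≤_) (sym (degree≡∑ G v)) (injective⇒≤∑χ (adj G v) g g-inj adj-g)

↑-elim : ∀ k {m} (P : Fin (k + m) → Set) →
         (∀ i → P (i ↑ˡ m)) → (∀ x → P (k ↑ʳ x)) → ∀ u → P u
↑-elim k P left right u with splitAt k u in eq
... | inj₁ i = subst P (Fin.splitAt⁻¹-↑ˡ eq) (left i)
... | inj₂ x = subst P (Fin.splitAt⁻¹-↑ʳ eq) (right x)

twoBlock : ∀ k m → ℕ → ℕ → Seq (k + m)
twoBlock k m a b u = [ const a , const b ]′ (splitAt k u)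

module _ (k m : ℕ) {a b : ℕ} where

  twoBlock-↑ˡ : ∀ i → twoBlock k m a b (i ↑ˡ m) ≡ a
  twoBlock-↑ˡ i rewrite Fin.splitAt-↑ˡ k i m = refl

  twoBlock-↑ʳ : ∀ x → twoBlock k m a b (k ↑ʳ x) ≡ b
  twoBlock-↑ʳ x rewrite Fin.splitAt-↑ʳ k m x = refl

  σ-twoBlock : σ (twoBlock k m a b) ≡ k * a + m * b
  σ-twoBlock = begin
    σ (twoBlock k m a b)                                             ≡⟨ ∑-allFin (twoBlock k m a b) ⟩
    ∑ (twoBlock k m a b)                                             ≡⟨ ∑-↑ k (twoBlock k m a b) ⟩
    ∑ (twoBlock k m a b ∘ (_↑ˡ m)) + ∑ (twoBlock k m a b ∘ (k ↑ʳ_))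
      ≡⟨ cong₂ _+_ (trans (∑-cong twoBlock-↑ˡ) (∑-const k a))
                   (trans (∑-cong twoBlock-↑ʳ) (∑-const m b)) ⟩
    k * a + m * b                                                    ∎
    where open ≡-Reasoning

  twoBlock-< : ∀ u → toℕ u < k → twoBlock k m a b u ≡ a
  twoBlock-< u u<k rewrite Fin.splitAt-< k u u<k = refl

  twoBlock-≥ : ∀ u → k ≤ toℕ u → twoBlock k m a b u ≡ b
  twoBlock-≥ u k≤u rewrite Fin.splitAt-≥ k u k≤u = refl

  b≤twoBlock : b ≤ a → ∀ u → b ≤ twoBlock k m a b u
  b≤twoBlock b≤a u with splitAt k u
  ... | inj₁ _ = b≤a
  ... | inj₂ _ = ≤-refl

  twoBlock-nonIncreasing : b ≤ a → NonIncreasing (twoBlock k m a b)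
  twoBlock-nonIncreasing b≤a u v u≤v with toℕ v <? k
  ... | yes v<k rewrite twoBlock-< v v<k | twoBlock-< u (≤-<-trans u≤v v<k) = ≤-refl
  ... | no  v≮k rewrite twoBlock-≥ v (≮⇒≥ v≮k) = b≤twoBlock b≤a u

module _ (k : ℕ) {m : ℕ} (H : Graph m) where

  joinAdj : Fin k ⊎ Fin m → Fin k ⊎ Fin m → Bool
  joinAdj (inj₁ i) (inj₁ j) = not (does (i ≟ j))
  joinAdj (inj₁ _) (inj₂ _) = true
  joinAdj (inj₂ _) (inj₁ _) = true
  joinAdj (inj₂ x) (inj₂ y) = adj H x y

  joinAdj-sym : ∀ s t → joinAdj s t ≡ joinAdj t s
  joinAdj-sym (inj₁ i) (inj₁ j) = cong not (does-⇔ (mk⇔ sym sym) (i ≟ j) (j ≟ i))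
  joinAdj-sym (inj₁ _) (inj₂ _) = refl
  joinAdj-sym (inj₂ _) (inj₁ _) = refl
  joinAdj-sym (inj₂ x) (inj₂ y) = Graph.sym H x y

  joinAdj-irrefl : ∀ s → joinAdj s s ≡ false
  joinAdj-irrefl (inj₁ i) = cong not (dec-true (i ≟ i) refl)
  joinAdj-irrefl (inj₂ x) = irrefl H x

  completeJoin : Graph (k + m)
  completeJoin = record
    { adj    = λ u v → joinAdj (splitAt k u) (splitAt k v)
    ; sym    = λ u v → joinAdj-sym (splitAt k u) (splitAt k v)
    ; irrefl = λ u → joinAdj-irrefl (splitAt k u)
    }

  joinDegree : Fin k ⊎ Fin m → ℕ
  joinDegree s = ∑ (χ ∘ joinAdj s ∘ inj₁) + ∑ (χ ∘ joinAdj s ∘ inj₂)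

  degree-completeJoin : ∀ u → degree completeJoin u ≡ joinDegree (splitAt k u)
  degree-completeJoin u = trans (degree≡∑ completeJoin u) (trans (∑-↑ k _) (cong₂ _+_
    (∑-cong (λ j → cong (χ ∘ joinAdj (splitAt k u)) (Fin.splitAt-↑ˡ k j m)))
    (∑-cong (λ y → cong (χ ∘ joinAdj (splitAt k u)) (Fin.splitAt-↑ʳ k m y)))))

  degree-completeJoin-↑ˡ : ∀ i → degree completeJoin (i ↑ˡ m) ≡ k + m ∸ 1
  degree-completeJoin-↑ˡ i = begin
    degree completeJoin (i ↑ˡ m)               ≡⟨ degree-completeJoin (i ↑ˡ m) ⟩
    joinDegree (splitAt k (i ↑ˡ m))            ≡⟨ cong joinDegree (Fin.splitAt-↑ˡ k i m) ⟩
    ∑ (λ j → χ (not (does (i ≟ j)))) + ∑ {m} (const 1)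
      ≡⟨ cong₂ _+_ (∑-χ-≢ i) (trans (∑-const m 1) (*-identityʳ m)) ⟩
    k ∸ 1 + m                                  ≡⟨ +-∸-comm m (≤-<-trans z≤n (Fin.toℕ<n i)) ⟨
    k + m ∸ 1                                  ∎
    where open ≡-Reasoning

  degree-completeJoin-↑ʳ : ∀ x → degree completeJoin (k ↑ʳ x) ≡ k + degree H x
  degree-completeJoin-↑ʳ x = begin
    degree completeJoin (k ↑ʳ x)     ≡⟨ degree-completeJoin (k ↑ʳ x) ⟩
    joinDegree (splitAt k (k ↑ʳ x))  ≡⟨ cong joinDegree (Fin.splitAt-↑ʳ k m x) ⟩
    ∑ {k} (const 1) + ∑ (χ ∘ adj H x)
      ≡⟨ cong₂ _+_ (trans (∑-const k 1) (*-identityʳ k)) (sym (degree≡∑ H x)) ⟩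
    k + degree H x                   ∎
    where open ≡-Reasoning

  completeJoin-realizes : ∀ {c} → (∀ x → degree H x ≡ c) →
                          Realizes completeJoin (twoBlock k m (k + m ∸ 1) (k + c))
  completeJoin-realizes H-regular = ↑-elim k _
    (λ i → trans (degree-completeJoin-↑ˡ i) (sym (twoBlock-↑ˡ k m i)))
    (λ x → trans (degree-completeJoin-↑ʳ x) (trans (cong (k +_) (H-regular x)) (sym (twoBlock-↑ʳ k m x))))

module _ {m : ℕ} .{{_ : NonZero m}} where

  rotate : ℕ → Fin m → Fin m
  rotate d i = (d + toℕ i) mod m

  toℕ-rotate : ∀ d i → toℕ (rotate d i) ≡ (d + toℕ i) % m
  toℕ-rotate d i = Fin.toℕ-fromℕ< _

  rotate-rotate : ∀ d e i → rotate d (rotate e i) ≡ rotate (d + e) i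
  rotate-rotate d e i = Fin.toℕ-injective (begin
    toℕ (rotate d (rotate e i))        ≡⟨ toℕ-rotate d (rotate e i) ⟩
    (d + toℕ (rotate e i)) % m         ≡⟨ cong (λ x → (d + x) % m) (toℕ-rotate e i) ⟩
    (d + (e + toℕ i) % m) % m          ≡⟨ %-distribˡ-+ d _ m ⟩
    (d % m + (e + toℕ i) % m % m) % m  ≡⟨ cong (λ x → (d % m + x) % m) (m%n%n≡m%n _ m) ⟩
    (d % m + (e + toℕ i) % m) % m      ≡⟨ %-distribˡ-+ d _ m ⟨
    (d + (e + toℕ i)) % m              ≡⟨ cong (_% m) (+-assoc d e (toℕ i)) ⟨
    (d + e + toℕ i) % m                ≡⟨ toℕ-rotate (d + e) i ⟨
    toℕ (rotate (d + e) i)             ∎)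
    where open ≡-Reasoning

  rotate-m : ∀ i → rotate m i ≡ i
  rotate-m i = Fin.toℕ-injective (begin
    toℕ (rotate m i)  ≡⟨ toℕ-rotate m i ⟩
    (m + toℕ i) % m   ≡⟨ cong (_% m) (+-comm m (toℕ i)) ⟩
    (toℕ i + m) % m   ≡⟨ [m+n]%n≡m%n (toℕ i) m ⟩
    toℕ i % m         ≡⟨ m<n⇒m%n≡m (Fin.toℕ<n i) ⟩
    toℕ i             ∎)
    where open ≡-Reasoning

  rotate-inverse : ∀ {d e} → d + e ≡ m → ∀ i → rotate d (rotate e i) ≡ i
  rotate-inverse {d} {e} d+e≡m i =
    trans (rotate-rotate d e i) (trans (cong (λ s → rotate s i) d+e≡m) (rotate-m i))

  rotate-≢ : ∀ {d} → 0 < d → d < m → ∀ i → rotate d i ≢ i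
  rotate-≢ {d} 0<d d<m i eq = <⇒≱ d<m (∣⇒≤ {{>-nonZero 0<d}} m∣d)
    where
    j q : ℕ
    j = toℕ i
    q = (d + j) / m
    m∣d : m ∣ d
    m∣d = divides q (+-cancelʳ-≡ j d (q * m) (begin
      d + j                  ≡⟨ m≡m%n+[m/n]*n (d + j) m ⟩
      (d + j) % m + q * m    ≡⟨ cong (_+ q * m) (trans (sym (toℕ-rotate d i)) (cong toℕ eq)) ⟩
      j + q * m              ≡⟨ +-comm j (q * m) ⟩
      q * m + j              ∎))
      where open ≡-Reasoning

  cycleAdj : Fin m → Fin m → Bool
  cycleAdj x y = does (y ≟ rotate 1 x) ∨ does (x ≟ rotate 1 y)

  module _ (2<m : 2 < m) where

    cycle : Graph m
    cycle = record
      { adj    = cycleAdj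
      ; sym    = λ x y → ∨-comm (does (y ≟ rotate 1 x)) _
      ; irrefl = λ x → cong (λ b → b ∨ b) (dec-false (x ≟ rotate 1 x) (rotate-≢ z<s 1<m x ∘ sym))
      }
      where
      1<m : 1 < m
      1<m = <-trans (s<s z<s) 2<m

    cycle-2-regular : ∀ x → degree cycle x ≡ 2
    cycle-2-regular x = begin
      degree cycle x                         ≡⟨ degree≡∑ cycle x ⟩
      ∑ (χ ∘ cycleAdj x)                     ≡⟨ ∑-cong split ⟩
      ∑ (λ y → χ (isNext y) + χ (isPrev y))  ≡⟨ ∑-distrib-+ (χ ∘ isNext) (χ ∘ isPrev) ⟩
      ∑ (χ ∘ isNext) + ∑ (χ ∘ isPrev)        ≡⟨ cong₂ _+_ (∑-χ-≟ next) (∑-χ-≟ prev) ⟩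
      2                                      ∎
      where
      open ≡-Reasoning
      1≤m : 1 ≤ m
      1≤m = >-nonZero⁻¹ m
      next prev : Fin m
      next = rotate 1 x
      prev = rotate (m ∸ 1) x
      isNext isPrev : Fin m → Bool
      isNext y = does (y ≟ next)
      isPrev y = does (y ≟ prev)
      next≢prev : next ≢ prev
      next≢prev eq = rotate-≢ z<s 2<m x (begin
        rotate 2 x     ≡⟨ rotate-rotate 1 1 x ⟨
        rotate 1 next  ≡⟨ cong (rotate 1) eq ⟩
        rotate 1 prev  ≡⟨ rotate-inverse (m+[n∸m]≡n 1≤m) x ⟩
        x              ∎)
      succ⇔pred : ∀ y → does (x ≟ rotate 1 y) ≡ isPrev y
      succ⇔pred y = does-⇔ (mk⇔
        (λ eq → trans (sym (rotate-inverse (m∸n+n≡m 1≤m) y)) (cong (rotate (m ∸ 1)) (sym eq)))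
        (λ eq → trans (sym (rotate-inverse (m+[n∸m]≡n 1≤m) x)) (cong (rotate 1) (sym eq))))
        (x ≟ rotate 1 y) (y ≟ prev)
      split : ∀ y → χ (cycleAdj x y) ≡ χ (isNext y) + χ (isPrev y)
      split y = trans (cong (λ b → χ (isNext y ∨ b)) (succ⇔pred y)) (χ-∨-≟ next≢prev y)

-- The removed path is 1 – 0 – 2, so each of the vertices 3, …, r is adjacent to all the others.
KMinusP2-highDegrees : ∀ {k n} (G : Graph n) → ContainsKMinusP2 (3 + k) G →
  Σ (Fin (suc k) → Fin n) λ g → Injective _≡_ _≡_ g × ∀ t → 3 + k ≤ degree G (g t)
KMinusP2-highDegrees {k} G (f , f-inj , f-adj) = f ∘ outer , outer-inj , outer-degree
  where
  outer : Fin (suc k) → Fin (4 + k)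
  outer t = Fin.suc (Fin.suc (Fin.suc t))
  outer-inj : Injective _≡_ _≡_ (f ∘ outer)
  outer-inj = Fin.suc-injective ∘ Fin.suc-injective ∘ Fin.suc-injective ∘ f-inj
  outer-∉P2 : ∀ t j → ¬ P2Edge (outer t) j
  outer-∉P2 t j (inj₁ (() , _))
  outer-∉P2 t j (inj₂ (_ , inj₁ ()))
  outer-∉P2 t j (inj₂ (_ , inj₂ ()))
  outer-degree : ∀ t → 3 + k ≤ degree G (f (outer t))
  outer-degree t = injective⇒≤degree G _ (f ∘ punchIn (outer t))
    (Fin.punchIn-injective (outer t) _ _ ∘ f-inj)
    (λ u → f-adj _ _ (punchInᵢ≢i (outer t) u ∘ sym , outer-∉P2 t _))

twoBlock-highDegrees≤k : ∀ {k m a b c s} (G : Graph (k + m)) → Realizes G (twoBlock k m a b) →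
  b < c → (g : Fin s → Fin (k + m)) → Injective _≡_ _≡_ g → (∀ t → c ≤ degree G (g t)) → s ≤ k
twoBlock-highDegrees≤k {k} {m} {s = s} G realizes b<c g g-inj high = Fin.injective⇒≤ ψ-inj
  where
  core : ∀ t → toℕ (g t) < k
  core t = ≰⇒> λ k≤g →
    <⇒≱ b<c (subst (_ ≤_) (trans (realizes (g t)) (twoBlock-≥ k m (g t) k≤g)) (high t))
  ψ : Fin s → Fin k
  ψ t = fromℕ< (core t)
  ψ-inj : Injective _≡_ _≡_ ψ
  ψ-inj e = g-inj (Fin.toℕ-injective (Fin.fromℕ<-injective _ _ (core _) (core _) e))

twoBlock-notPotentially : ∀ {k m a b} → b < 3 + k → ¬ PotentiallyKMinusP2 (3 + k) (twoBlock k m a b)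
twoBlock-notPotentially b<r (G , realizes , contains) =
  let g , g-inj , high = KMinusP2-highDegrees G contains
  in 1+n≰n (twoBlock-highDegrees≤k G realizes b<r g g-inj high)

extremal-graphic : ∀ k {m} → 2 < m → Graphic (twoBlock k m (k + m ∸ 1) (k + 2))
extremal-graphic k {m} 2<m =
  twoBlock-nonIncreasing k m k+2≤k+m-1 , completeJoin k C , completeJoin-realizes k C (cycle-2-regular 2<m)
  where
  k+2≤k+m-1 : k + 2 ≤ k + m ∸ 1
  k+2≤k+m-1 = m+n≤o⇒m≤o∸n (k + 2) (≤-trans (≤-reflexive (+-assoc k 2 1)) (+-monoʳ-≤ k 2<m))
  instance
    m≢0 : NonZero m
    m≢0 = >-nonZero (<-trans z<s 2<m)
  C : Graph m
  C = cycle 2<m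

2∣n*[1+n] : ∀ n → 2 ∣ n * suc n
2∣n*[1+n] zero    = divides 0 refl
2∣n*[1+n] (suc n) = subst (2 ∣_) step (∣m∣n⇒∣m+n (2∣n*[1+n] n) (m∣m*n (suc n)))
  where
  step : n * suc n + 2 * suc n ≡ suc n * suc (suc n)
  step = solve (n ∷ [])

even<+2⇒≤ : ∀ {l s} → 2 ∣ l → 2 ∣ s → l < s + 2 → l ≤ s
even<+2⇒≤ (divides q refl) (divides t refl) l<s+2 =
  *-monoˡ-≤ 2 (s≤s⁻¹ (*-cancelʳ-< 2 q (suc t) (subst (q * 2 <_) (+-comm (t * 2) 2) l<s+2)))

m≡n+o⇒m∸n≡o : ∀ {m} n o → m ≡ n + o → m ∸ n ≡ o
m≡n+o⇒m∸n≡o n o refl = m+n∸m≡n n o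

-- Here r = 3 + k and n = k + (3 + p).
module _ (k p : ℕ) where

  n≡r+p : k + (3 + p) ≡ 3 + k + p
  n≡r+p = solve (k ∷ p ∷ [])

  π : Seq (k + (3 + p))
  π = twoBlock k (3 + p) (k + (3 + p) ∸ 1) (k + 2)

  bound : ℕ
  bound = (2 + k) * (2 * (k + (3 + p)) ∸ (3 + k)) ∸ 2 * (k + (3 + p) ∸ (3 + k))

  σπ-closed : σ π ≡ k * (k + (2 + p)) + (3 + p) * (k + 2)
  σπ-closed = trans (σ-twoBlock k (3 + p))
    (cong (λ a → k * a + (3 + p) * (k + 2)) (+-∸-assoc k {3 + p} (s≤s z≤n)))

  σπ-even : 2 ∣ σ π
  σπ-even = subst (2 ∣_) (trans closed (sym σπ-closed))
    (∣m∣n⇒∣m+n (2∣n*[1+n] (2 + k)) (m∣m*n (p * (1 + k))))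
    where
    closed : (2 + k) * suc (2 + k) + 2 * (p * (1 + k)) ≡ k * (k + (2 + p)) + (3 + p) * (k + 2)
    closed = solve (k ∷ p ∷ [])

  bound≡σπ : bound ≡ σ π
  bound≡σπ = begin
    bound
      ≡⟨ cong₂ (λ x y → (2 + k) * x ∸ 2 * y)
               (m≡n+o⇒m∸n≡o (3 + k) _ 2n≡r+[r+2p]) (m≡n+o⇒m∸n≡o (3 + k) p n≡r+p) ⟩
    (2 + k) * (3 + k + 2 * p) ∸ 2 * p       ≡⟨ m≡n+o⇒m∸n≡o (2 * p) _ expand ⟩
    k * (k + (2 + p)) + (3 + p) * (k + 2)   ≡⟨ σπ-closed ⟨
    σ π                                     ∎
    where
    open ≡-Reasoning
    2n≡r+[r+2p] : 2 * (k + (3 + p)) ≡ 3 + k + (3 + k + 2 * p)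
    2n≡r+[r+2p] = solve (k ∷ p ∷ [])
    expand : (2 + k) * (3 + k + 2 * p) ≡ 2 * p + (k * (k + (2 + p)) + (3 + p) * (k + 2))
    expand = solve (k ∷ p ∷ [])

  even<bound+2⇒≤σπ : ∀ {l} → 2 ∣ l → l < bound + 2 → l ≤ σ π
  even<bound+2⇒≤σπ 2∣l l<bound+2 =
    even<+2⇒≤ 2∣l σπ-even (subst (λ b → _ < b + 2) bound≡σπ l<bound+2)

lemma3p3 : ∀ (r n : ℕ) → 3 ≤ r → suc r ≤ n →
    SigmaKMinusP2AtLeast r n (((r ∸ 1) * (2 * n ∸ r) ∸ 2 * (n ∸ r)) + 2)
lemma3p3 (suc (suc (suc k))) n (s≤s (s≤s (s≤s _))) r<n l 2∣l l-suffices
  with p , r+p≡n ← m≤n⇒∃[o]m+o≡n (<⇒≤ r<n)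
  with refl ← trans (n≡r+p k p) r+p≡n
  = ≮⇒≥ λ l<bound+2 → twoBlock-notPotentially (≤-reflexive (+-comm (suc k) 2))
      (l-suffices (π k p) (extremal-graphic k (m≤m+n 3 p)) (even<bound+2⇒≤σπ k p 2∣l l<bound+2))
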